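{- Let $V$, $V'$ and $I$ be pairwise disjoint finite sets. (1) If $\pi:D_p^V\times C_2^I\to D_p$ is an epimorphism with $N=\ker(\pi)$, then there is $v\in V$ with $N=\ker(\pi_v)$. (2) If $|V|\ge|V'|$ and $\pi:D_p^V\times C_2^I\to D_p^{V'}$ is an epimorphism, then there is $V_0\subseteq V$ with $|V_0|=|V'|$ such that $\ker(\pi)=\bigcap_{v\in V_0}\ker(\pi_v)$.
   Context: $p$ is a fixed odd prime, $C_2=\{\pm1\}$ is the cyclic group of order $2$, and $D_p$ is the dihedral group of order $2p$. For $v\in V$, $\pi_v:D_p^V\times C_2^I\to D_p$ denotes the projection onto the $v$-th coordinate. -}

module Defs where

open import Data.Nat using (ℕ; NonZero; _+_; _∸_)
open import Data.Nat.DivMod using (_mod_)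
open import Data.Fin using (Fin; toℕ)
open import Data.Bool using (Bool; true; false; _xor_; if_then_else_)
open import Data.Product using (_×_; _,_; Σ; ∃)
open import Data.Vec using (Vec; lookup; zipWith; replicate)
open import Relation.Binary.PropositionalEquality using (_≡_)

-- Dihedral group D_p of order 2p: element (a , s) stands for r^a f^s
-- (r a rotation of order p, f a reflection, f r f = r⁻¹).
module _ (p : ℕ) .{{_ : NonZero p}} where

  D : Set
  D = Fin p × Bool

  negR : Fin p → Fin p
  negR a = (p ∸ toℕ a) mod p

  addR : Fin p → Fin p → Fin p
  addR a b = (toℕ a + toℕ b) mod p

  -- (r^a f^s)(r^b f^t) = r^(a ± b) f^(s xor t)
  Dmul : D → D → D
  Dmul (a , s) (b , t) = addR a (if s then negR b else b) , (s xor t)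

  De : D
  De = (0 mod p) , false

  -- the group D_p^V × C_2^I with |V| = n, |I| = m, C_2 = (Bool, xor)
  G : ℕ → ℕ → Set
  G n m = Vec D n × Vec Bool m

  Gmul : ∀ {n m} → G n m → G n m → G n m
  Gmul (x , c) (y , d) = zipWith Dmul x y , zipWith _xor_ c d

  Hmul : ∀ {k} → Vec D k → Vec D k → Vec D k
  Hmul = zipWith Dmul

  He : ∀ {k} → Vec D k
  He = replicate _ De

  proj : ∀ {n m} → Fin n → G n m → D
  proj v (x , _) = lookup x v

  IsHom : ∀ {n m} {H : Set} → (H → H → H) → (G n m → H) → Set
  IsHom {n} {m} _·_ f = ∀ (x y : G n m) → f (Gmul x y) ≡ (f x · f y)

  IsSurj : ∀ {A B : Set} → (A → B) → Set
  IsSurj {A} {B} f = ∀ (y : B) → Σ A (λ x → f x ≡ y)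

-- Since p is prime, a homomorphism out of the rotation subgroup ℤ/p of D_p that
-- kills a nonzero element is trivial.  As p is odd, it follows that an
-- endomorphism φ of D_p either kills the rotation r, and then its image has
-- exponent 2, or has trivial kernel, and then φ r is a nontrivial rotation and
-- φ s a reflection, two elements with trivial common centraliser.
--
-- A homomorphism π : D_p^(1+n) × C_2^m → D_p splits as π (d , y) = φ d · τ y,
-- where φ is an endomorphism and the values of φ and τ commute.  If φ r ≠ 1, the
-- centraliser argument gives τ = 1, so π = φ ∘ π_0 with φ injective.  Otherwise,
-- by induction on n, either τ = ψ ∘ π_v with ψ injective, and then φ s
-- centralises ψ r and ψ s, so φ = 1 and π = ψ ∘ π_(1+v); or τ, and hence π, has
-- image of exponent 2, which is impossible for surjective π since r² ≠ 1.  This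
-- proves (1).  For (2), each coordinate π_i of π is surjective, so by (1) it has
-- the kernel of some π_v; distinct i give distinct v (take x with π x equal to r
-- in one coordinate and 1 in all others), and V₀ is the set of these v.

module Submission where

open import Defs
open import Level using (0ℓ)
open import Algebra.Bundles using (AbelianGroup; Group; CommutativeRing)
open import Algebra.Structures using (IsAbelianGroup; IsGroup)
open import Algebra.Consequences.Propositional using (comm∧idˡ⇒id; comm∧invˡ⇒inv)
import Algebra.Definitions.RawMonoid as RawMonoidDefinitions
import Algebra.Properties.AbelianGroup as AbelianGroupProperties
import Algebra.Properties.CommutativeSemigroup as CommutativeSemigroupProperties
import Algebra.Properties.Group as GroupProperties
import Relation.Binary.Reasoning.Setoid as SetoidReasoning
open import Data.Empty using (⊥-elim)
open import Data.Bool as Bool using (Bool; true; false; not; _xor_)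
open import Data.Bool.Properties using (not-involutive; xor-same; xor-identityˡ; xor-identityʳ; xor-∧-commutativeRing)
open import Data.Nat as ℕ using (ℕ; NonZero; zero; suc; _*_; _∸_; _≤_; _<_; _%_; ≢-nonZero; nonTrivial⇒n>1)
open import Data.Nat.DivMod using (_mod_; %-distribˡ-+; m%n%n≡m%n; m<n⇒m%n≡m; n%n≡0; m*n%n≡0; [m+kn]%n≡m%n)
import Data.Nat.Properties as ℕ
open import Data.Nat.Primality using (Prime; prime⇒nonTrivial)
open import Data.Nat.Coprimality using (prime⇒coprime; coprime-Bézout)
open import Data.Nat.GCD using (module Bézout)
open import Data.Fin as Fin using (Fin; toℕ; _≟_)
open import Data.Fin.Properties using (toℕ-injective; toℕ-fromℕ<; toℕ<n; suc-injective)
open import Data.Fin.Subset using (Subset; _∈_; _∉_; ∣_∣; ⁅_⁆; _∪_; ⊥; inside; outside)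
open import Data.Fin.Subset.Properties using (∉⊥; x∈⁅x⁆; x∈⁅y⁆⇒x≡y; x∈p∪q⁻; x∈p∪q⁺; ∪-identityˡ; ∣⊥∣≡0)
open import Data.Vec using (Vec; []; _∷_; here; there; lookup; replicate; zipWith; map; _[_]≔_)
open import Data.Vec.Properties
  using (zipWith-identityˡ; zipWith-identityʳ; zipWith-inverseˡ; map-id; lookup∘update; lookup∘update′; lookup-zipWith; lookup-replicate)
open import Data.Vec.Relation.Binary.Pointwise.Extensional using (ext; Pointwise-≡⇒≡)
open import Data.Product using (_×_; _,_; Σ; ∃; proj₁; proj₂)
open import Data.Product.Properties using (≡-dec)
open import Data.Sum using (_⊎_; inj₁; inj₂)
open import Function using (_∘_; id)
open import Function.Bundles using (_⇔_; mk⇔; module Equivalence)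
open import Function.Definitions using (Injective)
open import Relation.Binary.PropositionalEquality
  using (_≡_; _≢_; refl; sym; trans; cong; cong₂; subst; module ≡-Reasoning)
open import Relation.Binary.PropositionalEquality.Algebra using (isMagma)
open import Relation.Binary.Definitions using (DecidableEquality)
open import Relation.Nullary using (yes; no; contradiction)

[m%d+n]%d≡[m+n]%d : ∀ m n d .{{_ : NonZero d}} → (m % d ℕ.+ n) % d ≡ (m ℕ.+ n) % d
[m%d+n]%d≡[m+n]%d m n d = begin
  (m % d ℕ.+ n) % d           ≡⟨ %-distribˡ-+ (m % d) n d ⟩
  (m % d % d ℕ.+ n % d) % d   ≡⟨ cong (λ k → (k ℕ.+ n % d) % d) (m%n%n≡m%n m d) ⟩
  (m % d ℕ.+ n % d) % d       ≡⟨ %-distribˡ-+ m n d ⟨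
  (m ℕ.+ n) % d               ∎
  where open ≡-Reasoning

[m+n%d]%d≡[m+n]%d : ∀ m n d .{{_ : NonZero d}} → (m ℕ.+ n % d) % d ≡ (m ℕ.+ n) % d
[m+n%d]%d≡[m+n]%d m n d = begin
  (m ℕ.+ n % d) % d  ≡⟨ cong (_% d) (ℕ.+-comm m (n % d)) ⟩
  (n % d ℕ.+ m) % d  ≡⟨ [m%d+n]%d≡[m+n]%d n m d ⟩
  (n ℕ.+ m) % d      ≡⟨ cong (_% d) (ℕ.+-comm n m) ⟩
  (m ℕ.+ n) % d      ∎
  where open ≡-Reasoning

image : ∀ {k n} → (Fin k → Fin n) → Subset n
image {zero}  f = ⊥
image {suc k} f = ⁅ f Fin.zero ⁆ ∪ image (f ∘ Fin.suc)

∈-image⁺ : ∀ {k n} (f : Fin k → Fin n) w → f w ∈ image f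
∈-image⁺ f Fin.zero    = x∈p∪q⁺ (inj₁ (x∈⁅x⁆ (f Fin.zero)))
∈-image⁺ f (Fin.suc w) = x∈p∪q⁺ {p = ⁅ f Fin.zero ⁆} (inj₂ (∈-image⁺ (f ∘ Fin.suc) w))

∈-image⁻ : ∀ {k n} (f : Fin k → Fin n) {v} → v ∈ image f → ∃ λ w → f w ≡ v
∈-image⁻ {zero}  f v∈ = contradiction v∈ ∉⊥
∈-image⁻ {suc k} f v∈ with x∈p∪q⁻ ⁅ f Fin.zero ⁆ (image (f ∘ Fin.suc)) v∈
... | inj₁ v∈⁅f0⁆ = Fin.zero , sym (x∈⁅y⁆⇒x≡y (f Fin.zero) v∈⁅f0⁆)
... | inj₂ v∈rest = let w , fw≡v = ∈-image⁻ (f ∘ Fin.suc) v∈rest in Fin.suc w , fw≡v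

x∉p⇒∣⁅x⁆∪p∣≡1+∣p∣ : ∀ {n} (x : Fin n) (p : Subset n) → x ∉ p → ∣ ⁅ x ⁆ ∪ p ∣ ≡ suc ∣ p ∣
x∉p⇒∣⁅x⁆∪p∣≡1+∣p∣ Fin.zero    (outside ∷ p) _   = cong (suc ∘ ∣_∣) (∪-identityˡ p)
x∉p⇒∣⁅x⁆∪p∣≡1+∣p∣ Fin.zero    (inside  ∷ p) x∉p = contradiction here x∉p
x∉p⇒∣⁅x⁆∪p∣≡1+∣p∣ (Fin.suc x) (outside ∷ p) x∉p = x∉p⇒∣⁅x⁆∪p∣≡1+∣p∣ x p (x∉p ∘ there)
x∉p⇒∣⁅x⁆∪p∣≡1+∣p∣ (Fin.suc x) (inside  ∷ p) x∉p = cong suc (x∉p⇒∣⁅x⁆∪p∣≡1+∣p∣ x p (x∉p ∘ there))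

∣image∣ : ∀ {k n} (f : Fin k → Fin n) → Injective _≡_ _≡_ f → ∣ image f ∣ ≡ k
∣image∣ {zero}  {n} f _     = ∣⊥∣≡0 n
∣image∣ {suc k}     f f-inj = trans
  (x∉p⇒∣⁅x⁆∪p∣≡1+∣p∣ (f Fin.zero) (image (f ∘ Fin.suc)) f0∉rest)
  (cong suc (∣image∣ (f ∘ Fin.suc) (suc-injective ∘ f-inj)))
  where
    f0∉rest : f Fin.zero ∉ image (f ∘ Fin.suc)
    f0∉rest f0∈ with () ← f-inj (proj₂ (∈-image⁻ (f ∘ Fin.suc) f0∈))

module ℤ/p (p : ℕ) .{{_ : NonZero p}} where

  infixl 6 _+_
  infix 8 -_

  _+_ : Fin p → Fin p → Fin p
  _+_ = addR p

  -_ : Fin p → Fin p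
  -_ = negR p

  0̂ 1̂ : Fin p
  0̂ = 0 mod p
  1̂ = 1 mod p

  toℕ-mod : ∀ m → toℕ (m mod p) ≡ m % p
  toℕ-mod m = toℕ-fromℕ< _

  toℕ-0̂ : toℕ 0̂ ≡ 0
  toℕ-0̂ = trans (toℕ-mod 0) (m*n%n≡0 0 p)

  toℕ-+ : ∀ a b → toℕ (a + b) ≡ (toℕ a ℕ.+ toℕ b) % p
  toℕ-+ a b = toℕ-mod (toℕ a ℕ.+ toℕ b)

  mod-cong : ∀ {m n} → m % p ≡ n % p → m mod p ≡ n mod p
  mod-cong {m} {n} eq = toℕ-injective (trans (toℕ-mod m) (trans eq (sym (toℕ-mod n))))

  mod-toℕ : ∀ a → toℕ a mod p ≡ a
  mod-toℕ a = toℕ-injective (trans (toℕ-mod (toℕ a)) (m<n⇒m%n≡m (toℕ<n a)))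

  +-comm : ∀ a b → a + b ≡ b + a
  +-comm a b = cong (_mod p) (ℕ.+-comm (toℕ a) (toℕ b))

  +-assoc : ∀ a b c → (a + b) + c ≡ a + (b + c)
  +-assoc a b c = mod-cong (begin
    (toℕ (a + b) ℕ.+ C) % p        ≡⟨ cong (λ k → (k ℕ.+ C) % p) (toℕ-+ a b) ⟩
    ((A ℕ.+ B) % p ℕ.+ C) % p      ≡⟨ [m%d+n]%d≡[m+n]%d (A ℕ.+ B) C p ⟩
    (A ℕ.+ B ℕ.+ C) % p            ≡⟨ cong (_% p) (ℕ.+-assoc A B C) ⟩
    (A ℕ.+ (B ℕ.+ C)) % p          ≡⟨ [m+n%d]%d≡[m+n]%d A (B ℕ.+ C) p ⟨
    (A ℕ.+ (B ℕ.+ C) % p) % p      ≡⟨ cong (λ k → (A ℕ.+ k) % p) (toℕ-+ b c) ⟨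
    (A ℕ.+ toℕ (b + c)) % p        ∎)
    where
      open ≡-Reasoning
      A = toℕ a
      B = toℕ b
      C = toℕ c

  +-identityˡ : ∀ a → 0̂ + a ≡ a
  +-identityˡ a = trans (mod-cong (cong (λ k → (k ℕ.+ toℕ a) % p) toℕ-0̂)) (mod-toℕ a)

  +-inverseˡ : ∀ a → - a + a ≡ 0̂
  +-inverseˡ a = mod-cong (begin
    (toℕ (- a) ℕ.+ A) % p        ≡⟨ cong (λ k → (k ℕ.+ A) % p) (toℕ-mod (p ∸ A)) ⟩
    ((p ∸ A) % p ℕ.+ A) % p      ≡⟨ [m%d+n]%d≡[m+n]%d (p ∸ A) A p ⟩
    (p ∸ A ℕ.+ A) % p            ≡⟨ cong (_% p) (ℕ.m∸n+n≡m (ℕ.<⇒≤ (toℕ<n a))) ⟩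
    p % p                        ≡⟨ n%n≡0 p ⟩
    0                            ≡⟨ m*n%n≡0 0 p ⟨
    0 % p                        ∎)
    where
      open ≡-Reasoning
      A = toℕ a

  +-isAbelianGroup : IsAbelianGroup _≡_ _+_ 0̂ -_
  +-isAbelianGroup = record
    { isGroup = record
      { isMonoid = record
        { isSemigroup = record { isMagma = isMagma _+_ ; assoc = +-assoc }
        ; identity = comm∧idˡ⇒id +-comm +-identityˡ
        }
      ; inverse = comm∧invˡ⇒inv +-comm +-inverseˡ
      ; ⁻¹-cong = cong -_
      }
    ; comm = +-comm
    }

  +-abelianGroup : AbelianGroup 0ℓ 0ℓ
  +-abelianGroup = record { isAbelianGroup = +-isAbelianGroup }

  open AbelianGroup +-abelianGroup public using () renaming (identityʳ to +-identityʳ; inverseʳ to +-inverseʳ)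
  open AbelianGroupProperties +-abelianGroup public using (⁻¹-∙-comm; ⁻¹-involutive; ε⁻¹≈ε)
  open CommutativeSemigroupProperties (AbelianGroup.commutativeSemigroup +-abelianGroup) public
    using (interchange)
  open RawMonoidDefinitions (AbelianGroup.rawMonoid +-abelianGroup) public using () renaming (_×_ to _•_)

  toℕ-• : ∀ k a → toℕ (k • a) ≡ (k * toℕ a) % p
  toℕ-• zero    a = toℕ-mod 0
  toℕ-• (suc k) a = begin
    toℕ (a + k • a)                  ≡⟨ toℕ-+ a (k • a) ⟩
    (toℕ a ℕ.+ toℕ (k • a)) % p      ≡⟨ cong (λ n → (toℕ a ℕ.+ n) % p) (toℕ-• k a) ⟩
    (toℕ a ℕ.+ (k * toℕ a) % p) % p  ≡⟨ [m+n%d]%d≡[m+n]%d (toℕ a) (k * toℕ a) p ⟩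
    (suc k * toℕ a) % p              ∎
    where open ≡-Reasoning

module Dihedral (p : ℕ) .{{_ : NonZero p}} where

  open ℤ/p p

  infixl 7 _·_
  infix 8 _⁻¹ _²

  _·_ : D p → D p → D p
  _·_ = Dmul p

  E : D p
  E = De p

  _⁻¹ : D p → D p
  (a , false) ⁻¹ = - a , false
  (a , true)  ⁻¹ = a , true

  ·-assoc : ∀ x y z → (x · y) · z ≡ x · (y · z)
  ·-assoc (a , false) (b , t)     (c , u) = cong (_, t xor u) (+-assoc a b _)
  ·-assoc (a , true)  (b , false) (c , u) =
    cong (_, not u) (trans (+-assoc a (- b) (- c)) (cong (a +_) (⁻¹-∙-comm b c)))
  ·-assoc (a , true)  (b , true)  (c , u) = cong₂ _,_
    (trans (+-assoc a (- b) c)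
           (cong (a +_) (trans (cong (- b +_) (sym (⁻¹-involutive c))) (⁻¹-∙-comm b (- c)))))
    (sym (not-involutive u))

  ·-identityˡ : ∀ x → E · x ≡ x
  ·-identityˡ (b , t) = cong (_, t) (+-identityˡ b)

  ·-identityʳ : ∀ x → x · E ≡ x
  ·-identityʳ (a , false) = cong (_, false) (+-identityʳ a)
  ·-identityʳ (a , true)  = cong (_, true) (trans (cong (a +_) ε⁻¹≈ε) (+-identityʳ a))

  ·-inverseˡ : ∀ x → x ⁻¹ · x ≡ E
  ·-inverseˡ (a , false) = cong (_, false) (+-inverseˡ a)
  ·-inverseˡ (a , true)  = cong (_, false) (+-inverseʳ a)

  ·-inverseʳ : ∀ x → x · x ⁻¹ ≡ E
  ·-inverseʳ (a , false) = cong (_, false) (+-inverseʳ a)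
  ·-inverseʳ (a , true)  = cong (_, false) (+-inverseʳ a)

  ·-isGroup : IsGroup _≡_ _·_ E _⁻¹
  ·-isGroup = record
    { isMonoid = record
      { isSemigroup = record { isMagma = isMagma _·_ ; assoc = ·-assoc }
      ; identity = ·-identityˡ , ·-identityʳ
      }
    ; inverse = ·-inverseˡ , ·-inverseʳ
    ; ⁻¹-cong = cong _⁻¹
    }

  D-group : Group 0ℓ 0ℓ
  D-group = record { isGroup = ·-isGroup }

  open GroupProperties D-group public using (identityˡ-unique)

  _≟ᴰ_ : DecidableEquality (D p)
  _≟ᴰ_ = ≡-dec _≟_ Bool._≟_

  rot : Fin p → D p
  rot a = a , false

  r s : D p
  r = rot 1̂
  s = 0̂ , true

  _² : D p → D p
  x ² = x · x

  rot-decomposition : ∀ a t → (a , t) ≡ rot a · (0̂ , t)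
  rot-decomposition a t = cong (_, t) (sym (+-identityʳ a))

  rotation-comm : ∀ {x y} → proj₂ x ≡ false → proj₂ y ≡ false → x · y ≡ y · x
  rotation-comm {a , false} {b , false} refl refl = cong (_, false) (+-comm a b)

  reflection² : ∀ {x} → proj₂ x ≡ true → x ² ≡ E
  reflection² {a , true} refl = cong (_, false) (+-inverseʳ a)

  ²-rotation : ∀ x → x ² ≡ rot (proj₁ (x ²))
  ²-rotation (a , false) = refl
  ²-rotation (a , true)  = refl

  commute⇒²-distrib : ∀ x y → x · y ≡ y · x → (x · y) ² ≡ x ² · y ²
  commute⇒²-distrib x y xy≡yx = begin
    (x · y) ²         ≡⟨ ·-assoc x y (x · y) ⟩
    x · (y · (x · y)) ≡⟨ cong (x ·_) (·-assoc y x y) ⟨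
    x · (y · x · y)   ≡⟨ cong (λ z → x · (z · y)) xy≡yx ⟨
    x · (x · y · y)   ≡⟨ cong (x ·_) (·-assoc x y y) ⟩
    x · (x · y ²)     ≡⟨ ·-assoc x x (y ²) ⟨
    x ² · y ²         ∎
    where open ≡-Reasoning

  commute∧²≡E⇒²≡E : ∀ x y → x · y ≡ y · x → (x · y) ² ≡ E → x ² ≡ E → y ² ≡ E
  commute∧²≡E⇒²≡E x y xy≡yx xy²≡E x²≡E = begin
    y ²         ≡⟨ ·-identityˡ (y ²) ⟨
    E · y ²     ≡⟨ cong (_· y ²) x²≡E ⟨
    x ² · y ²   ≡⟨ commute⇒²-distrib x y xy≡yx ⟨
    (x · y) ²   ≡⟨ xy²≡E ⟩
    E           ∎
    where open ≡-Reasoning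

module OddPrime (p : ℕ) .{{_ : NonZero p}} (p-prime : Prime p) (odd : p % 2 ≡ 1) where

  open ℤ/p p
  open Dihedral p

  1<p : 1 < p
  1<p = nonTrivial⇒n>1 p {{prime⇒nonTrivial p-prime}}

  2<p : 2 < p
  2<p = ℕ.≤∧≢⇒< 1<p (λ 2≡p → ℕ.0≢1+n (trans (cong (_% 2) 2≡p) odd))

  toℕ-1̂ : toℕ 1̂ ≡ 1
  toℕ-1̂ = trans (toℕ-mod 1) (m<n⇒m%n≡m 1<p)

  1̂≢0̂ : 1̂ ≢ 0̂
  1̂≢0̂ 1̂≡0̂ = ℕ.1+n≢0 (trans (sym toℕ-1̂) (trans (cong toℕ 1̂≡0̂) toℕ-0̂))

  1̂+1̂≢0̂ : 1̂ + 1̂ ≢ 0̂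
  1̂+1̂≢0̂ eq = ℕ.0≢1+n (begin
    0                            ≡⟨ toℕ-0̂ ⟨
    toℕ 0̂                        ≡⟨ cong toℕ eq ⟨
    toℕ (1̂ + 1̂)                  ≡⟨ toℕ-+ 1̂ 1̂ ⟩
    (toℕ 1̂ ℕ.+ toℕ 1̂) % p        ≡⟨ cong (λ n → (n ℕ.+ n) % p) toℕ-1̂ ⟩
    2 % p                        ≡⟨ m<n⇒m%n≡m 2<p ⟩
    2                            ∎)
    where open ≡-Reasoning

  toℕ[a]•1̂≡a : ∀ a → toℕ a • 1̂ ≡ a
  toℕ[a]•1̂≡a a = toℕ-injective (begin
    toℕ (toℕ a • 1̂)       ≡⟨ toℕ-• (toℕ a) 1̂ ⟩
    (toℕ a * toℕ 1̂) % p   ≡⟨ cong (λ n → (toℕ a * n) % p) toℕ-1̂ ⟩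
    (toℕ a * 1) % p       ≡⟨ cong (_% p) (ℕ.*-identityʳ (toℕ a)) ⟩
    toℕ a % p             ≡⟨ m<n⇒m%n≡m (toℕ<n a) ⟩
    toℕ a                 ∎)
    where open ≡-Reasoning

  bézout-• : ∀ {a} → a ≢ 0̂ → ∃ λ k → k • a ≡ 1̂ ⊎ 1̂ + k • a ≡ 0̂
  bézout-• {a} a≢0̂ with coprime-Bézout (prime⇒coprime p-prime {{≢-nonZero toℕa≢0}} (toℕ<n a))
    where
      toℕa≢0 : toℕ a ≢ 0
      toℕa≢0 eq = a≢0̂ (toℕ-injective (trans eq (sym toℕ-0̂)))
  ... | Bézout.-+ x y eq = y , inj₁ (toℕ-injective (begin
    toℕ (y • a)         ≡⟨ toℕ-• y a ⟩
    (y * toℕ a) % p     ≡⟨ cong (_% p) eq ⟨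
    (1 ℕ.+ x * p) % p   ≡⟨ [m+kn]%n≡m%n 1 x p ⟩
    1 % p               ≡⟨ toℕ-mod 1 ⟨
    toℕ 1̂               ∎))
    where open ≡-Reasoning
  ... | Bézout.+- x y eq = y , inj₂ (mod-cong (begin
    (toℕ 1̂ ℕ.+ toℕ (y • a)) % p   ≡⟨ cong₂ (λ m n → (m ℕ.+ n) % p) toℕ-1̂ (toℕ-• y a) ⟩
    (1 ℕ.+ (y * toℕ a) % p) % p   ≡⟨ [m+n%d]%d≡[m+n]%d 1 (y * toℕ a) p ⟩
    (1 ℕ.+ y * toℕ a) % p         ≡⟨ cong (_% p) eq ⟩
    (x * p) % p                   ≡⟨ m*n%n≡0 x p ⟩
    0                             ≡⟨ m*n%n≡0 0 p ⟨
    0 % p                         ∎))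
    where open ≡-Reasoning

  module _ {c ℓ} (H : Group c ℓ) where

    open Group H using (Carrier; _≈_; _∙_; ε; setoid; ∙-congˡ; ∙-cong; identityˡ; identityʳ)
    open GroupProperties H using () renaming (identityˡ-unique to H-identityˡ-unique)
    open SetoidReasoning setoid

    module _ {ψ : Fin p → Carrier} (ψ-hom : ∀ a b → ψ (a + b) ≈ ψ a ∙ ψ b) where

      hom-0̂ : ψ 0̂ ≈ ε
      hom-0̂ = H-identityˡ-unique (ψ 0̂) (ψ 0̂) (begin
        ψ 0̂ ∙ ψ 0̂   ≈⟨ ψ-hom 0̂ 0̂ ⟨
        ψ (0̂ + 0̂)   ≡⟨ cong ψ (+-identityˡ 0̂) ⟩
        ψ 0̂         ∎)

      kernel-• : ∀ {a} → ψ a ≈ ε → ∀ k → ψ (k • a) ≈ ε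
      kernel-• ψa≈ε zero    = hom-0̂
      kernel-• {a} ψa≈ε (suc k) = begin
        ψ (a + k • a)      ≈⟨ ψ-hom a (k • a) ⟩
        ψ a ∙ ψ (k • a)    ≈⟨ ∙-cong ψa≈ε (kernel-• ψa≈ε k) ⟩
        ε ∙ ε              ≈⟨ identityˡ ε ⟩
        ε                  ∎

      kernel-nonzero⇒1̂ : ∀ {a} → a ≢ 0̂ → ψ a ≈ ε → ψ 1̂ ≈ ε
      kernel-nonzero⇒1̂ {a} a≢0̂ ψa≈ε with bézout-• a≢0̂
      ... | k , inj₁ k•a≡1̂ = begin
        ψ 1̂         ≡⟨ cong ψ k•a≡1̂ ⟨
        ψ (k • a)   ≈⟨ kernel-• ψa≈ε k ⟩
        ε           ∎
      ... | k , inj₂ 1̂+k•a≡0̂ = begin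
        ψ 1̂               ≈⟨ identityʳ (ψ 1̂) ⟨
        ψ 1̂ ∙ ε           ≈⟨ ∙-congˡ (kernel-• ψa≈ε k) ⟨
        ψ 1̂ ∙ ψ (k • a)   ≈⟨ ψ-hom 1̂ (k • a) ⟨
        ψ (1̂ + k • a)     ≡⟨ cong ψ 1̂+k•a≡0̂ ⟩
        ψ 0̂               ≈⟨ hom-0̂ ⟩
        ε                 ∎

      kernel-nonzero⇒trivial : ∀ {a} → a ≢ 0̂ → ψ a ≈ ε → ∀ b → ψ b ≈ ε
      kernel-nonzero⇒trivial a≢0̂ ψa≈ε b = begin
        ψ b               ≡⟨ cong ψ (toℕ[a]•1̂≡a b) ⟨
        ψ (toℕ b • 1̂)     ≈⟨ kernel-• (kernel-nonzero⇒1̂ a≢0̂ ψa≈ε) (toℕ b) ⟩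
        ε                 ∎

  -- Doubling is an endomorphism of ℤ/p that does not kill 1̂.
  a+a≡0̂⇒a≡0̂ : ∀ a → a + a ≡ 0̂ → a ≡ 0̂
  a+a≡0̂⇒a≡0̂ a a+a≡0̂ with a ≟ 0̂
  ... | yes a≡0̂ = a≡0̂
  ... | no  a≢0̂ = ⊥-elim (1̂+1̂≢0̂ (kernel-nonzero⇒trivial (AbelianGroup.group +-abelianGroup)
                                    (λ a b → interchange a b a b) a≢0̂ a+a≡0̂ 1̂))

  rotation²≡E⇒≡E : ∀ {x} → proj₂ x ≡ false → x ² ≡ E → x ≡ E
  rotation²≡E⇒≡E {a , false} refl x²≡E = cong (_, false) (a+a≡0̂⇒a≡0̂ a (cong proj₁ x²≡E))

  r≢E : r ≢ E
  r≢E r≡E = 1̂≢0̂ (cong proj₁ r≡E)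

  r²≢E : r ² ≢ E
  r²≢E r²≡E = 1̂+1̂≢0̂ (cong proj₁ r²≡E)

  centralizer-trivial : ∀ {x y z} → proj₂ x ≡ false → x ≢ E → proj₂ y ≡ true →
                        z · x ≡ x · z → z · y ≡ y · z → z ≡ E
  centralizer-trivial {x} {z = c , true} x-rot x≢E _ zx≡xz _ = ⊥-elim (x≢E (rotation²≡E⇒≡E x-rot
    (commute∧²≡E⇒²≡E (c , true) x zx≡xz (reflection² (cong (true xor_) x-rot)) (reflection² refl))))
  centralizer-trivial {y = y} {c , false} _ _ y-refl _ zy≡yz = rotation²≡E⇒≡E refl
    (commute∧²≡E⇒²≡E y (c , false) (sym zy≡yz) (reflection² (cong (_xor false) y-refl)) (reflection² y-refl))

  IsEndomorphism : (D p → D p) → Set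
  IsEndomorphism φ = ∀ x y → φ (x · y) ≡ φ x · φ y

  module Endomorphism (φ : D p → D p) (φ-hom : IsEndomorphism φ) where

    φ-E : φ E ≡ E
    φ-E = identityˡ-unique (φ E) (φ E) (trans (sym (φ-hom E E)) (cong φ (·-identityˡ E)))

    φ-reflection²≡E : ∀ {x} → proj₂ x ≡ true → φ x ² ≡ E
    φ-reflection²≡E {x} x-refl = trans (sym (φ-hom x x)) (trans (cong φ (reflection² x-refl)) φ-E)

    φ∘rot-hom : ∀ a b → φ (rot (a + b)) ≡ φ (rot a) · φ (rot b)
    φ∘rot-hom a b = φ-hom (rot a) (rot b)

    -- proj₂ ∘ φ ∘ rot : ℤ/p → C₂ kills 1̂ + 1̂, which is nonzero as p is odd.
    φ-rotation : ∀ a → proj₂ (φ (rot a)) ≡ false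
    φ-rotation = kernel-nonzero⇒trivial (CommutativeRing.+-group xor-∧-commutativeRing)
      (λ a b → cong proj₂ (φ∘rot-hom a b)) 1̂+1̂≢0̂ (trans (cong proj₂ (φ∘rot-hom 1̂ 1̂)) (xor-same (proj₂ (φ r))))

    φr≡E⇒φ∘rot≡E : φ r ≡ E → ∀ a → φ (rot a) ≡ E
    φr≡E⇒φ∘rot≡E = kernel-nonzero⇒trivial D-group φ∘rot-hom 1̂≢0̂

    φr≡E⇒φ²≡E : φ r ≡ E → ∀ x → φ x ² ≡ E
    φr≡E⇒φ²≡E φr≡E x = begin
      φ x ²                   ≡⟨ φ-hom x x ⟨
      φ (x ²)                 ≡⟨ cong φ (²-rotation x) ⟩
      φ (rot (proj₁ (x ²)))   ≡⟨ φr≡E⇒φ∘rot≡E φr≡E (proj₁ (x ²)) ⟩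
      E                       ∎
      where open ≡-Reasoning

    φr≡E∧φs≡E⇒φ≡E : φ r ≡ E → φ s ≡ E → ∀ x → φ x ≡ E
    φr≡E∧φs≡E⇒φ≡E φr≡E φs≡E (a , t) = begin
      φ (a , t)                 ≡⟨ cong φ (rot-decomposition a t) ⟩
      φ (rot a · (0̂ , t))       ≡⟨ φ-hom (rot a) (0̂ , t) ⟩
      φ (rot a) · φ (0̂ , t)     ≡⟨ cong₂ _·_ (φr≡E⇒φ∘rot≡E φr≡E a) (φ-0̂ t) ⟩
      E · E                     ≡⟨ ·-identityˡ E ⟩
      E                         ∎
      where
        open ≡-Reasoning
        φ-0̂ : ∀ t → φ (0̂ , t) ≡ E
        φ-0̂ false = φ-E
        φ-0̂ true  = φs≡E

    φs-reflection : φ r ≢ E → proj₂ (φ s) ≡ true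
    φs-reflection φr≢E with proj₂ (φ s) in φs-rot
    ... | true  = refl
    ... | false = ⊥-elim (φr≢E (rotation²≡E⇒≡E (φ-rotation 1̂)
      (commute∧²≡E⇒²≡E (φ s) (φ r) (rotation-comm φs-rot (φ-rotation 1̂))
        (trans (cong _² (sym (φ-hom s r))) (φ-reflection²≡E refl))
        (φ-reflection²≡E refl))))

    φ-reflection : φ r ≢ E → ∀ a → proj₂ (φ (a , true)) ≡ true
    φ-reflection φr≢E a = begin
      proj₂ (φ (a , true))       ≡⟨ cong (proj₂ ∘ φ) (rot-decomposition a true) ⟩
      proj₂ (φ (rot a · s))      ≡⟨ cong proj₂ (φ-hom (rot a) s) ⟩
      proj₂ (φ (rot a) · φ s)    ≡⟨ cong₂ _xor_ (φ-rotation a) (φs-reflection φr≢E) ⟩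
      true                       ∎
      where open ≡-Reasoning

    kernel-trivial : φ r ≢ E → ∀ x → φ x ≡ E → x ≡ E
    kernel-trivial φr≢E (a , true) φx≡E with () ← trans (sym (φ-reflection φr≢E a)) (cong proj₂ φx≡E)
    kernel-trivial φr≢E (a , false) φx≡E with a ≟ 0̂
    ... | yes a≡0̂ = cong (_, false) a≡0̂
    ... | no  a≢0̂ = ⊥-elim (φr≢E (kernel-nonzero⇒trivial D-group φ∘rot-hom a≢0̂ φx≡E 1̂))

    centralizer : φ r ≢ E → ∀ {z} → z · φ r ≡ φ r · z → z · φ s ≡ φ s · z → z ≡ E
    centralizer φr≢E = centralizer-trivial (φ-rotation 1̂) φr≢E (φs-reflection φr≢E)

  infixl 7 _⊗_
  _⊗_ : ∀ {n m} → G p n m → G p n m → G p n m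
  _⊗_ = Gmul p

  e : ∀ {n m} → G p n m
  e {n} {m} = replicate n E , replicate m false

  hom-e : ∀ {n m} {π : G p n m → D p} → IsHom p (Dmul p) π → π e ≡ E
  hom-e {π = π} π-hom = identityˡ-unique (π e) (π e) (trans (sym (π-hom e e)) (cong π e⊗e≡e))
    where
      e⊗e≡e : e ⊗ e ≡ e
      e⊗e≡e = cong₂ _,_ (zipWith-identityˡ ·-identityˡ _) (zipWith-identityˡ xor-identityˡ _)

  C₂-exponent-2 : ∀ {m} {π : G p 0 m → D p} → IsHom p (Dmul p) π → ∀ x → π x ² ≡ E
  C₂-exponent-2 {π = π} π-hom ([] , c) = begin
    π ([] , c) ²                         ≡⟨ π-hom ([] , c) ([] , c) ⟨
    π ([] , zipWith _xor_ c c)           ≡⟨ cong (λ c′ → π ([] , zipWith _xor_ c′ c)) (map-id c) ⟨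
    π ([] , zipWith _xor_ (map id c) c)  ≡⟨ cong (λ c′ → π ([] , c′)) (zipWith-inverseˡ {⁻¹ = id} xor-same c) ⟩
    π e                                  ≡⟨ hom-e {π = π} π-hom ⟩
    E                                    ∎
    where open ≡-Reasoning

  single : ∀ {n m} → Fin n → D p → G p n m
  single {n} v d = (replicate n E [ v ]≔ d) , replicate _ false

  proj-single : ∀ {n m} (v : Fin n) d → proj p v (single {m = m} v d) ≡ d
  proj-single {n} v d = lookup∘update v (replicate n E) d

  data Shape {n m} (π : G p n m → D p) : Set where
    via-coordinate : (v : Fin n) (φ : D p → D p) → IsEndomorphism φ → φ r ≢ E →
                     (∀ x → π x ≡ φ (proj p v x)) → Shape π
    exponent-2 : (∀ x → π x ² ≡ E) → Shape π

  module Split {n m} {π : G p (suc n) m → D p} (π-hom : IsHom p (Dmul p) π) where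

    head : D p → G p (suc n) m
    head d = (d ∷ replicate n E) , replicate m false

    tail : G p n m → G p (suc n) m
    tail (xs , c) = (E ∷ xs) , c

    φ : D p → D p
    φ = π ∘ head

    τ : G p n m → D p
    τ = π ∘ tail

    φ-hom : IsEndomorphism φ
    φ-hom d d′ = trans (cong π head-hom) (π-hom (head d) (head d′))
      where
        head-hom : head (d · d′) ≡ head d ⊗ head d′
        head-hom = cong₂ _,_ (cong (d · d′ ∷_) (sym (zipWith-identityˡ ·-identityˡ _)))
                             (sym (zipWith-identityˡ xor-identityˡ _))

    τ-hom : IsHom p (Dmul p) τ
    τ-hom x@(xs , c) y@(ys , d) = trans (cong π tail-hom) (π-hom (tail x) (tail y))
      where
        tail-hom : tail (x ⊗ y) ≡ tail x ⊗ tail y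
        tail-hom = cong (λ d₀ → (d₀ ∷ zipWith (Dmul p) xs ys) , zipWith _xor_ c d) (sym (·-identityˡ E))

    π-split : ∀ d xs c → π ((d ∷ xs) , c) ≡ φ d · τ (xs , c)
    π-split d xs c = trans (cong π (sym head⊗tail)) (π-hom (head d) (tail (xs , c)))
      where
        head⊗tail : head d ⊗ tail (xs , c) ≡ ((d ∷ xs) , c)
        head⊗tail = cong₂ _,_ (cong₂ _∷_ (·-identityʳ d) (zipWith-identityˡ ·-identityˡ xs))
                              (zipWith-identityˡ xor-identityˡ c)

    φτ-commute : ∀ d y → φ d · τ y ≡ τ y · φ d
    φτ-commute d y@(xs , c) = begin
      φ d · τ y              ≡⟨ π-split d xs c ⟨
      π ((d ∷ xs) , c)       ≡⟨ cong π tail⊗head ⟨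
      π (tail y ⊗ head d)    ≡⟨ π-hom (tail y) (head d) ⟩
      τ y · φ d              ∎
      where
        open ≡-Reasoning
        tail⊗head : tail y ⊗ head d ≡ ((d ∷ xs) , c)
        tail⊗head = cong₂ _,_ (cong₂ _∷_ (·-identityˡ d) (zipWith-identityʳ ·-identityʳ xs))
                              (zipWith-identityʳ xor-identityʳ c)

    open Endomorphism φ φ-hom

    via-head : φ r ≢ E → ∀ x → π x ≡ φ (proj p Fin.zero x)
    via-head φr≢E ((d ∷ xs) , c) = begin
      π ((d ∷ xs) , c)    ≡⟨ π-split d xs c ⟩
      φ d · τ (xs , c)    ≡⟨ cong (φ d ·_) τ≡E ⟩
      φ d · E             ≡⟨ ·-identityʳ (φ d) ⟩
      φ d                 ∎
      where
        open ≡-Reasoning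
        τ≡E : τ (xs , c) ≡ E
        τ≡E = centralizer φr≢E (sym (φτ-commute r (xs , c))) (sym (φτ-commute s (xs , c)))

    via-tail : φ r ≡ E → ∀ v ψ → IsEndomorphism ψ → ψ r ≢ E →
               (∀ y → τ y ≡ ψ (proj p v y)) → ∀ x → π x ≡ ψ (proj p (Fin.suc v) x)
    via-tail φr≡E v ψ ψ-hom ψr≢E τ≡ψ ((d ∷ xs) , c) = begin
      π ((d ∷ xs) , c)      ≡⟨ π-split d xs c ⟩
      φ d · τ (xs , c)      ≡⟨ cong₂ _·_ (φ≡E d) (τ≡ψ (xs , c)) ⟩
      E · ψ (lookup xs v)   ≡⟨ ·-identityˡ (ψ (lookup xs v)) ⟩
      ψ (lookup xs v)       ∎
      where
        open ≡-Reasoning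
        φs-commutes : ∀ d → φ s · ψ d ≡ ψ d · φ s
        φs-commutes d = subst (λ z → φ s · z ≡ z · φ s)
          (trans (τ≡ψ (single v d)) (cong ψ (proj-single {m = m} v d))) (φτ-commute s (single v d))
        φ≡E : ∀ d → φ d ≡ E
        φ≡E = φr≡E∧φs≡E⇒φ≡E φr≡E
          (Endomorphism.centralizer ψ ψ-hom ψr≢E (φs-commutes r) (φs-commutes s))

    exponent-2-tail : φ r ≡ E → (∀ y → τ y ² ≡ E) → ∀ x → π x ² ≡ E
    exponent-2-tail φr≡E τ²≡E ((d ∷ xs) , c) = begin
      π ((d ∷ xs) , c) ²      ≡⟨ cong _² (π-split d xs c) ⟩
      (φ d · τ (xs , c)) ²    ≡⟨ commute⇒²-distrib (φ d) (τ (xs , c)) (φτ-commute d (xs , c)) ⟩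
      φ d ² · τ (xs , c) ²    ≡⟨ cong₂ _·_ (φr≡E⇒φ²≡E φr≡E d) (τ²≡E (xs , c)) ⟩
      E · E                   ≡⟨ ·-identityˡ E ⟩
      E                       ∎
      where open ≡-Reasoning

    shape-suc : Shape τ → Shape π
    shape-suc shape-τ with φ r ≟ᴰ E | shape-τ
    ... | no φr≢E  | _ = via-coordinate Fin.zero φ φ-hom φr≢E (via-head φr≢E)
    ... | yes φr≡E | via-coordinate v ψ ψ-hom ψr≢E τ≡ψ =
      via-coordinate (Fin.suc v) ψ ψ-hom ψr≢E (via-tail φr≡E v ψ ψ-hom ψr≢E τ≡ψ)
    ... | yes φr≡E | exponent-2 τ²≡E = exponent-2 (exponent-2-tail φr≡E τ²≡E)

  shape : ∀ {n m} (π : G p n m → D p) → IsHom p (Dmul p) π → Shape π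
  shape {zero}  π π-hom = exponent-2 (C₂-exponent-2 {π = π} π-hom)
  shape {suc n} π π-hom = shape-suc (shape τ τ-hom)
    where open Split {π = π} π-hom

  surjective⇒kernel-coordinate : ∀ {n m} (π : G p n m → D p) → IsHom p (Dmul p) π → IsSurj p π →
    Σ (Fin n) (λ v → (x : G p n m) → (π x ≡ E) ⇔ (proj p v x ≡ E))
  surjective⇒kernel-coordinate π π-hom π-surj with shape π π-hom
  ... | via-coordinate v φ φ-hom φr≢E π≡φ = v , λ x → mk⇔
    (λ πx≡E → kernel-trivial φr≢E (proj p v x) (trans (sym (π≡φ x)) πx≡E))
    (λ xᵥ≡E → trans (π≡φ x) (trans (cong φ xᵥ≡E) φ-E))
    where open Endomorphism φ φ-hom
  ... | exponent-2 π²≡E with x , πx≡r ← π-surj r =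
    ⊥-elim (r²≢E (subst (λ z → z ² ≡ E) πx≡r (π²≡E x)))

  module _ {n n′ m} {π : G p n m → Vec (D p) n′} (π-hom : IsHom p (Hmul p) π) (π-surj : IsSurj p π) where

    πᵢ : Fin n′ → G p n m → D p
    πᵢ i x = lookup (π x) i

    πᵢ-hom : ∀ i → IsHom p (Dmul p) (πᵢ i)
    πᵢ-hom i x y = trans (cong (λ z → lookup z i) (π-hom x y)) (lookup-zipWith (Dmul p) i (π x) (π y))

    πᵢ-surj : ∀ i → IsSurj p (πᵢ i)
    πᵢ-surj i d = let x , πx≡d = π-surj (replicate n′ d) in
      x , trans (cong (λ z → lookup z i) πx≡d) (lookup-replicate i d)

    coordinate : Fin n′ → Fin n
    coordinate i = proj₁ (surjective⇒kernel-coordinate (πᵢ i) (πᵢ-hom i) (πᵢ-surj i))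

    πᵢ-kernel : ∀ i x → (πᵢ i x ≡ E) ⇔ (proj p (coordinate i) x ≡ E)
    πᵢ-kernel i = proj₂ (surjective⇒kernel-coordinate (πᵢ i) (πᵢ-hom i) (πᵢ-surj i))

    coordinate-injective : Injective _≡_ _≡_ coordinate
    coordinate-injective {i} {j} cᵢ≡cⱼ with i ≟ j
    ... | yes i≡j = i≡j
    ... | no  i≢j with x , πx≡rⱼ ← π-surj (replicate n′ E [ j ]≔ r) =
      contradiction (trans (sym πⱼx≡r) πⱼx≡E) r≢E
      where
        πⱼx≡r : πᵢ j x ≡ r
        πⱼx≡r = trans (cong (λ z → lookup z j) πx≡rⱼ) (lookup∘update j (replicate n′ E) r)
        πᵢx≡E : πᵢ i x ≡ E
        πᵢx≡E = trans (cong (λ z → lookup z i) πx≡rⱼ)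
                      (trans (lookup∘update′ i≢j (replicate n′ E) r) (lookup-replicate i E))
        πⱼx≡E : πᵢ j x ≡ E
        πⱼx≡E = Equivalence.from (πᵢ-kernel j x)
                  (subst (λ v → proj p v x ≡ E) cᵢ≡cⱼ (Equivalence.to (πᵢ-kernel i x) πᵢx≡E))

    kernel⇒image-coordinates : ∀ x → π x ≡ He p → ∀ v → v ∈ image coordinate → proj p v x ≡ E
    kernel⇒image-coordinates x πx≡E v v∈ with i , cᵢ≡v ← ∈-image⁻ coordinate v∈ =
      subst (λ v → proj p v x ≡ E) cᵢ≡v
        (Equivalence.to (πᵢ-kernel i x) (trans (cong (λ z → lookup z i) πx≡E) (lookup-replicate i E)))

    image-coordinates⇒kernel : ∀ x → (∀ v → v ∈ image coordinate → proj p v x ≡ E) → π x ≡ He p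
    image-coordinates⇒kernel x xᵥ≡E = Pointwise-≡⇒≡ (ext λ i →
      trans (Equivalence.from (πᵢ-kernel i x) (xᵥ≡E (coordinate i) (∈-image⁺ coordinate i)))
            (sym (lookup-replicate i E)))

    surjective⇒kernel-coordinates : Σ (Subset n) (λ V₀ → (∣ V₀ ∣ ≡ n′) ×
      ((x : G p n m) → (π x ≡ He p) ⇔ ((v : Fin n) → v ∈ V₀ → proj p v x ≡ E)))
    surjective⇒kernel-coordinates =
      image coordinate , ∣image∣ coordinate coordinate-injective ,
      λ x → mk⇔ (kernel⇒image-coordinates x) (image-coordinates⇒kernel x)

lemma2p5 : (p : ℕ) .{{_ : NonZero p}} → Prime p → p % 2 ≡ 1 → (n n' m : ℕ) →
  ((π : G p n m → D p) → IsHom p (Dmul p) π → IsSurj p π →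
    Σ (Fin n) (λ v → (x : G p n m) → (π x ≡ De p) ⇔ (proj p v x ≡ De p)))
  × (n' ≤ n → (π : G p n m → Vec (D p) n') → IsHom p (Hmul p) π → IsSurj p π →
    Σ (Subset n) (λ V₀ → (∣ V₀ ∣ ≡ n') ×
      ((x : G p n m) → (π x ≡ He p) ⇔ ((v : Fin n) → v ∈ V₀ → proj p v x ≡ De p))))
lemma2p5 p p-prime odd n n' m =
  surjective⇒kernel-coordinate ,
  λ _ π π-hom π-surj → surjective⇒kernel-coordinates π-hom π-surj
  where open OddPrime p p-prime odd
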